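{- Let $G=(V,E)$ be a connected simple undirected graph, let $\delta>0$, let $s$ be a positive integer, and let $S=\{m_1,\dots,m_s\}$ be a multiset of $s$ vertices of $V$. Let $q\in V$ be a vertex such that $\Phi^{*}(q)\le\Phi^{*}(v)+\delta s$ for every $v\in N(q)$. Then $\Lambda^{*}(q)\le\frac{s(1+\delta)}{2}$.
   Context: $d$ is the shortest-path distance in $G$ and $N(v)$ is the set of neighbours of $v$. For $q\in V$ and $u\in N(q)$, $N(q,u)$ is the set of vertices $x\in V$ such that $u$ lies on a shortest path from $q$ to $x$. $\Phi^{*}(v)=\sum_{i=1}^{s}d(m_i,v)$. For $X\subseteq V$, $S\cap X$ is the multiset $\{m_i:m_i\in X\}$ and $|S\cap X|$ its size counted with multiplicity. $\Lambda^{*}(v)=\max_{u\in N(v)}|S\cap N(v,u)|$. (In the paper $S$ is a random sample drawn proportionally to vertex weights and $s=\frac{8\ln n}{\delta^2}$, but the statement is deterministic in $S$.)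
   Formalization: The parameter δ ranges over the positive rationals. -}

module Defs where

open import Level using (0ℓ)
open import Data.Nat using (ℕ; zero; suc; _+_; _≤_; _⊔_)
open import Data.Nat.Properties using (_≟_)
open import Data.Fin using (Fin)
open import Data.Bool using (Bool; true; false; T)
open import Data.Vec using (Vec; []; _∷_)
open import Data.List using (List; filter; map; foldr)
open import Data.List.Base using (allFin)
open import Data.Product using (Σ; _×_; ∃)
open import Relation.Nullary using (Dec; yes; no; ¬_)
open import Relation.Unary using (Pred; Decidable)
open import Relation.Binary.PropositionalEquality using (_≡_)

record Graph : Set where
  field
    n     : ℕ
    adj   : Fin n → Fin n → Bool
    sym   : ∀ u v → adj u v ≡ adj v u
    irrefl : ∀ v → adj v v ≡ false

module _ (G : Graph) where
  open Graph G

  V : Set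
  V = Fin n

  Adj : V → V → Set
  Adj u v = T (adj u v)

  data Walk : V → V → ℕ → Set where
    here : ∀ {v} → Walk v v zero
    step : ∀ {u w v k} → Adj u w → Walk w v k → Walk u v (suc k)

  Connected : Set
  Connected = ∀ u v → ∃ λ k → Walk u v k

  IsDistance : (V → V → ℕ) → Set
  IsDistance d = ∀ u v → Walk u v (d u v) × (∀ k → Walk u v k → d u v ≤ k)

  neighbours : V → List V
  neighbours v = filter (λ u → Data.Bool._≟_ (adj v u) true) (allFin n)

  module Dist (d : V → V → ℕ) where
    -- x ∈ N(q,u) : u lies on a shortest path from q to x
    InN : V → V → Pred V 0ℓ
    InN q u x = d q u + d u x ≡ d q x

    InN? : ∀ q u → Decidable (InN q u)
    InN? q u x = (d q u + d u x) ≟ d q x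

    count : ∀ {P : Pred V 0ℓ} → Decidable P → ∀ {s} → Vec V s → ℕ
    count P? [] = 0
    count P? (m ∷ ms) with P? m
    ... | yes _ = suc (count P? ms)
    ... | no _  = count P? ms

    Φ* : ∀ {s} → Vec V s → V → ℕ
    Φ* [] v = 0
    Φ* (m ∷ ms) v = d m v + Φ* ms v

    -- Λ*(v) = max_{u ∈ N(v)} |S ∩ N(v,u)|   (max of empty list = 0)
    Λ* : ∀ {s} → Vec V s → V → ℕ
    Λ* S v = foldr _⊔_ 0 (map (λ u → count (InN? v u) S) (neighbours v))

module Submission where

-- Fix a neighbour u of q and write c = |S ∩ N(q,u)|.
-- For a sample point m, moving the reference vertex from q to u changes
-- d(m,·) by at most one (triangle inequality along the edge qu), and if u
-- lies on a shortest q–m path it decreases it by exactly one.  Summing over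
-- the sample gives the "drop inequality"  Φ*(u) + 2c ≤ Φ*(q) + s.  Together
-- with the local-optimality hypothesis Φ*(q) ≤ Φ*(u) + δs this yields
-- 2c ≤ s + δs, i.e. c ≤ s(1+δ)/2.  Finally Λ*(q) is a maximum over the
-- neighbours of q (or 0), and any bound satisfied by 0 and by every entry
-- of a list is satisfied by its maximum.

open import Defs
open import Data.Nat using (ℕ) renaming (_<_ to _<ℕ_)
open import Data.Integer using (+_)
open import Data.Rational using (ℚ; _/_; _≤_; _<_; _+_; _*_; 0ℚ; 1ℚ; ½)
open import Data.Vec using (Vec)

open import Data.Nat as ℕ using (zero; suc; z≤n; s≤s; _⊔_)
import Data.Nat.Properties as ℕ
open import Data.Nat.Tactic.RingSolver using (solve-∀)
import Data.Integer as ℤ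
import Data.Integer.Properties as ℤ
open import Data.Nat.Coprimality using (1-coprimeTo) renaming (sym to coprime-sym)
open import Data.Rational using (mkℚ; *≤*; -_; NonNegative; nonNegative)
open import Data.Rational.Properties
  using (normalize-coprime; ≤-refl; ≤-trans; <⇒≤; +-mono-≤; +-monoʳ-≤;
         *-monoˡ-≤-nonNeg; nonNegative⁻¹; nonNeg+nonNeg⇒nonNeg; nonNeg*nonNeg⇒nonNeg)
open import Data.Rational.Solver using (module +-*-Solver)
open import Relation.Binary.PropositionalEquality
  using (_≡_; _≢_; refl; sym; trans; cong; cong₂; subst; subst₂; module ≡-Reasoning)
open import Data.Product using (proj₁; proj₂)
open import Data.Sum using (inj₁; inj₂)
open import Data.Empty using (⊥; ⊥-elim)
open import Data.Bool using (T; true) renaming (_≟_ to _≟ᵇ_)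
open import Data.Bool.Properties using (T-≡)
open import Data.List using (List; []; _∷_; foldr; map; allFin)
open import Data.List.Membership.Propositional using (_∈_)
open import Data.List.Membership.Propositional.Properties using (∈-filter⁻)
open import Data.List.Relation.Unary.Any using (here; there)
open import Data.Vec using ([]; _∷_)
open import Function.Bundles using (Equivalence)
open import Relation.Nullary using (yes; no)

max-preserves : ∀ {A : Set} (P : ℕ → Set) (f : A → ℕ) (xs : List A) →
  P 0 → (∀ {x} → x ∈ xs → P (f x)) → P (foldr _⊔_ 0 (map f xs))
max-preserves P f []       P0 Pf = P0
max-preserves P f (x ∷ xs) P0 Pf
  with ℕ.⊔-sel (f x) (foldr _⊔_ 0 (map f xs))
... | inj₁ max≡fx   = subst P (sym max≡fx) (Pf (here refl))
... | inj₂ max≡rest = subst P (sym max≡rest)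
                        (max-preserves P f xs P0 (λ x∈xs → Pf (there x∈xs)))

ι : ℕ → ℚ
ι a = + a / 1

ι-reduced : ∀ a → ι a ≡ mkℚ (+ a) 0 (coprime-sym (1-coprimeTo a))
ι-reduced a = normalize-coprime (coprime-sym (1-coprimeTo a))

ι-homo-+ : ∀ a b → ι (a ℕ.+ b) ≡ ι a + ι b
ι-homo-+ a b = begin
  + (a ℕ.+ b) / 1
    ≡⟨ cong (_/ 1) (sym (cong₂ ℤ._+_ (ℤ.*-identityʳ (+ a)) (ℤ.*-identityʳ (+ b)))) ⟩
  (+ a ℤ.* + 1 ℤ.+ + b ℤ.* + 1) / 1
    ≡⟨⟩
  mkℚ (+ a) 0 (coprime-sym (1-coprimeTo a)) + mkℚ (+ b) 0 (coprime-sym (1-coprimeTo b))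
    ≡⟨ sym (cong₂ _+_ (ι-reduced a) (ι-reduced b)) ⟩
  ι a + ι b ∎
  where open ≡-Reasoning

ι-mono-≤ : ∀ {a b} → a ℕ.≤ b → ι a ≤ ι b
ι-mono-≤ {a} {b} a≤b = subst₂ _≤_ (sym (ι-reduced a)) (sym (ι-reduced b))
  (*≤* (subst₂ ℤ._≤_ (sym (ℤ.*-identityʳ (+ a))) (sym (ℤ.*-identityʳ (+ b)))
         (ℤ.+≤+ a≤b)))

-- The bound s(1+δ)/2 of the theorem is nonnegative when s, δ ≥ 0; this
-- covers a vertex without neighbours, where Λ* = 0.
half-bound-nonNeg : ∀ T δ → 0ℚ ≤ T → 0ℚ ≤ δ → 0ℚ ≤ ½ * (T * (1ℚ + δ))
half-bound-nonNeg T δ 0≤T 0≤δ = nonNegative⁻¹ (½ * (T * (1ℚ + δ)))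
  where
  instance
    T-nonNeg : NonNegative T
    T-nonNeg = nonNegative 0≤T
    δ-nonNeg : NonNegative δ
    δ-nonNeg = nonNegative 0≤δ
    1+δ-nonNeg : NonNegative (1ℚ + δ)
    1+δ-nonNeg = nonNeg+nonNeg⇒nonNeg 1ℚ δ
    product-nonNeg : NonNegative (T * (1ℚ + δ))
    product-nonNeg = nonNeg*nonNeg⇒nonNeg T (1ℚ + δ)
    bound-nonNeg : NonNegative (½ * (T * (1ℚ + δ)))
    bound-nonNeg = nonNeg*nonNeg⇒nonNeg ½ (T * (1ℚ + δ))

drop-bound : ∀ A B K T δ → A + (K + K) ≤ B + T → B ≤ A + δ * T →
  K ≤ ½ * (T * (1ℚ + δ))
drop-bound A B K T δ drop near-opt =
  subst₂ _≤_ (halve K) (half-sum T δ) (*-monoˡ-≤-nonNeg ½ double-bound)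
  where
  open +-*-Solver
  cancel : ∀ A X → (- A) + (A + X) ≡ X
  cancel = solve 2 (λ A X → (:- A) :+ (A :+ X) := X) refl
  rearrange : ∀ A T δ → (- A) + ((A + δ * T) + T) ≡ δ * T + T
  rearrange = solve 3 (λ A T δ → (:- A) :+ ((A :+ δ :* T) :+ T) := δ :* T :+ T) refl
  halve : ∀ K → ½ * (K + K) ≡ K
  halve = solve 1 (λ K → con ½ :* (K :+ K) := K) refl
  half-sum : ∀ T δ → ½ * (δ * T + T) ≡ ½ * (T * (1ℚ + δ))
  half-sum = solve 2 (λ T δ → con ½ :* (δ :* T :+ T) := con ½ :* (T :* (con 1ℚ :+ δ))) refl
  double-bound : K + K ≤ δ * T + T
  double-bound = subst₂ _≤_ (cancel A (K + K)) (rearrange A T δ)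
    (+-monoʳ-≤ (- A) (≤-trans drop (+-mono-≤ near-opt (≤-refl {T}))))

shift-in : ∀ x y c → x ℕ.+ y ℕ.+ (suc c ℕ.+ suc c) ≡ suc (suc x) ℕ.+ (y ℕ.+ (c ℕ.+ c))
shift-in = solve-∀

shift-out : ∀ x y n → suc x ℕ.+ (y ℕ.+ n) ≡ x ℕ.+ y ℕ.+ suc n
shift-out = solve-∀

module Metric (G : Graph) (d : V G → V G → ℕ) (isD : IsDistance G d) where
  open Dist G d

  adj-sym : ∀ {u v} → Adj G u v → Adj G v u
  adj-sym {u} {v} = subst T (Graph.sym G u v)

  no-loop : ∀ {v} → Adj G v v → ⊥
  no-loop {v} = subst T (Graph.irrefl G v)

  walk-snoc : ∀ {a b c k} → Walk G a b k → Adj G b c → Walk G a c (suc k)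
  walk-snoc here       e = step e here
  walk-snoc (step e′ w) e = step e′ (walk-snoc w e)

  walk-reverse : ∀ {a b k} → Walk G a b k → Walk G b a k
  walk-reverse here       = here
  walk-reverse (step e w) = walk-snoc (walk-reverse w) (adj-sym e)

  walk-append : ∀ {a b c k l} → Walk G a b k → Walk G b c l → Walk G a c (k ℕ.+ l)
  walk-append here       w′ = w′
  walk-append (step e w) w′ = step e (walk-append w w′)

  walk-length-0 : ∀ {a b} → Walk G a b 0 → a ≡ b
  walk-length-0 here = refl

  geodesic : ∀ a b → Walk G a b (d a b)
  geodesic a b = proj₁ (isD a b)

  minimal : ∀ {a b k} → Walk G a b k → d a b ℕ.≤ k
  minimal {a} {b} = proj₂ (isD a b) _

  d-sym : ∀ a b → d a b ≡ d b a
  d-sym a b = ℕ.≤-antisym (minimal (walk-reverse (geodesic b a)))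
                          (minimal (walk-reverse (geodesic a b)))

  d-triangle : ∀ a b c → d a c ℕ.≤ d a b ℕ.+ d b c
  d-triangle a b c = minimal (walk-append (geodesic a b) (geodesic b c))

  d-pos : ∀ {a b} → a ≢ b → 1 ℕ.≤ d a b
  d-pos {a} {b} a≢b with d a b | geodesic a b
  ... | zero  | w = ⊥-elim (a≢b (walk-length-0 w))
  ... | suc _ | _ = s≤s z≤n

  d-edge : ∀ {q u} → Adj G q u → d q u ≡ 1
  d-edge {q} {u} e = ℕ.≤-antisym (minimal (step e here)) (d-pos q≢u)
    where
    q≢u : q ≢ u
    q≢u refl = no-loop e

  d-step : ∀ m {q u} → Adj G q u → d m u ℕ.≤ suc (d m q)
  d-step m {q} {u} e = begin
    d m u             ≤⟨ d-triangle m q u ⟩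
    d m q ℕ.+ d q u   ≡⟨ cong (d m q ℕ.+_) (d-edge e) ⟩
    d m q ℕ.+ 1       ≡⟨ ℕ.+-comm (d m q) 1 ⟩
    suc (d m q)       ∎
    where open ℕ.≤-Reasoning

  d-on-geodesic : ∀ m {q u} → Adj G q u → InN q u m → suc (d m u) ≡ d m q
  d-on-geodesic m {q} {u} e on-path = begin
    suc (d m u)       ≡⟨ cong (λ k → k ℕ.+ d m u) (sym (d-edge e)) ⟩
    d q u ℕ.+ d m u   ≡⟨ cong (d q u ℕ.+_) (d-sym m u) ⟩
    d q u ℕ.+ d u m   ≡⟨ on-path ⟩
    d q m             ≡⟨ d-sym q m ⟩
    d m q             ∎
    where open ≡-Reasoning

  Φ*-drop : ∀ {q u} → Adj G q u → ∀ {s} (S : Vec (V G) s) →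
    Φ* S u ℕ.+ (count (InN? q u) S ℕ.+ count (InN? q u) S) ℕ.≤ Φ* S q ℕ.+ s
  Φ*-drop e [] = z≤n
  Φ*-drop {q} {u} e {suc n} (m ∷ ms) with InN? q u m
  ... | yes on-path = begin
    d m u ℕ.+ Φu ℕ.+ (suc c ℕ.+ suc c)      ≡⟨ shift-in (d m u) Φu c ⟩
    suc (suc (d m u)) ℕ.+ (Φu ℕ.+ (c ℕ.+ c)) ≤⟨ ℕ.+-mono-≤ (ℕ.≤-reflexive (cong suc (d-on-geodesic m e on-path)))
                                                          (Φ*-drop e ms) ⟩
    suc (d m q) ℕ.+ (Φq ℕ.+ n)               ≡⟨ shift-out (d m q) Φq n ⟩
    d m q ℕ.+ Φq ℕ.+ suc n                   ∎
    where
    open ℕ.≤-Reasoning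
    Φu Φq c : ℕ
    Φu = Φ* ms u
    Φq = Φ* ms q
    c = count (InN? q u) ms
  ... | no _ = begin
    d m u ℕ.+ Φu ℕ.+ (c ℕ.+ c)               ≡⟨ ℕ.+-assoc (d m u) Φu (c ℕ.+ c) ⟩
    d m u ℕ.+ (Φu ℕ.+ (c ℕ.+ c))             ≤⟨ ℕ.+-mono-≤ (d-step m e) (Φ*-drop e ms) ⟩
    suc (d m q) ℕ.+ (Φq ℕ.+ n)               ≡⟨ shift-out (d m q) Φq n ⟩
    d m q ℕ.+ Φq ℕ.+ suc n                   ∎
    where
    open ℕ.≤-Reasoning
    Φu Φq c : ℕ
    Φu = Φ* ms u
    Φq = Φ* ms q
    c = count (InN? q u) ms

neighbour-bound : (G : Graph) → (d : V G → V G → ℕ) → IsDistance G d →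
  (δ : ℚ) → (s : ℕ) → (S : Vec (V G) s) → (q u : V G) → Adj G q u →
  ι (Dist.Φ* G d S q) ≤ ι (Dist.Φ* G d S u) + δ * ι s →
  ι (Dist.count G d (Dist.InN? G d q u) S) ≤ ½ * (ι s * (1ℚ + δ))
neighbour-bound G d isD δ s S q u e near-opt =
  drop-bound (ι (Φ* S u)) (ι (Φ* S q)) (ι c) (ι s) δ drop near-opt
  where
  open Dist G d
  c : ℕ
  c = count (InN? q u) S
  drop : ι (Φ* S u) + (ι c + ι c) ≤ ι (Φ* S q) + ι s
  drop = subst₂ _≤_
    (trans (ι-homo-+ (Φ* S u) (c ℕ.+ c)) (cong (λ x → ι (Φ* S u) + x) (ι-homo-+ c c)))
    (ι-homo-+ (Φ* S q) s)
    (ι-mono-≤ (Metric.Φ*-drop G d isD e S))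

lemma7 : (G : Graph) → Connected G →
    (d : V G → V G → ℕ) → IsDistance G d →
    (δ : ℚ) → 0ℚ < δ →
    (s : ℕ) → 0 <ℕ s → (S : Vec (V G) s) → (q : V G) →
    (∀ v → Adj G q v →
      (+ Dist.Φ* G d S q / 1) ≤ (+ Dist.Φ* G d S v / 1) + δ * (+ s / 1)) →
    (+ Dist.Λ* G d S q / 1) ≤ ½ * ((+ s / 1) * (1ℚ + δ))
lemma7 G _ d isD δ 0<δ s _ S q near-opt =
  max-preserves (λ k → ι k ≤ bound) (λ u → count (InN? q u) S) (neighbours G q)
    (half-bound-nonNeg (ι s) δ (ι-mono-≤ (z≤n {s})) (<⇒≤ 0<δ))
    (λ {u} u∈N → neighbour-bound G d isD δ s S q u (adjacent u∈N) (near-opt u (adjacent u∈N)))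
  where
  open Dist G d
  bound : ℚ
  bound = ½ * (ι s * (1ℚ + δ))
  adjacent : ∀ {u} → u ∈ neighbours G q → Adj G q u
  adjacent u∈N = Equivalence.from T-≡
    (proj₂ (∈-filter⁻ (λ v → Graph.adj G q v ≟ᵇ true) {xs = allFin (Graph.n G)} u∈N))
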